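{- For $I,J\in\mathcal I$ with $I\vartriangleleft J$, the unique $\vartriangleleft$-minimal set of $\mathcal M(I)$ equals the unique $\vartriangleleft$-minimal set of $\mathcal M(J)$.
   Context: Let $a_1,\dots,a_n$ be distinct integers between $1$ and $n$, and set $a_0=0$, so $A=(a_i)_{i=0,1,\dots,n}$. A set $I\subseteq\{0\}\cup[n]$ is feasible if $a_i<a_j$ for all $i,j\in I$ with $i<j$; $\mathcal I$ denotes the family of maximum-cardinality feasible sets. Patience sorting: start with empty piles $P_0,P_1,\dots,P_n$; for $i=0,1,\dots,n$ in this order, put $a_i$ on the top of the leftmost (smallest-index) pile $P_j$ that is empty or whose current top element is greater than $a_i$. Let $P_0,\dots,P_k$ be the resulting nonempty piles; "$a_u$ is placed below $a_v$" means $a_u$ was put on that pile before $a_v$. For $I,J\in\mathcal I$, write $I\vartriangleleft J$ if $I\setminus J=\{u\}$, $J\setminus I=\{v\}$, and $a_u$ is placed strictly below $a_v$ on the same pile $P_i$ for some $1\le i\le k$. For $I\in\mathcal I$, $\mathcal M(I)\subseteq\mathcal I$ is the smallest family containing $I$ such that $J\in\mathcal M(I)$ and $J'\vartriangleleft J$ imply $J'\in\mathcal M(I)$. A set $J\in\mathcal I$ is $\vartriangleleft$-minimal if there is no $J'\in\mathcal I$ with $J'\vartriangleleft J$; each $\mathcal M(I)$ contains exactly one $\vartriangleleft$-minimal set. -}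

module Defs where

open import Data.Nat using (ℕ; _<_; _≤_; _<ᵇ_)
open import Data.Bool using (if_then_else_)
open import Data.Fin using (Fin)
open import Data.Fin.Subset using (Subset; _∈_; ⁅_⁆; _─_; ∣_∣)
open import Data.List using (List; []; _∷_; foldl; allFin; drop)
open import Data.List.Relation.Unary.Any using (Any)
import Data.List.Membership.Propositional as LM
open import Data.Product using (_×_)
open import Relation.Binary.PropositionalEquality using (_≡_)
open import Relation.Nullary using (¬_)

-- Indices 0..n are Fin (suc n); the sequence A = (a_0,...,a_n) is a function.
module _ {n : ℕ} (a : Fin n → ℕ) where

  Feasible : Subset n → Set
  Feasible I = ∀ i j → i ∈ I → j ∈ I → i Data.Fin.< j → a i < a j

  MaxFeasible : Subset n → Set
  MaxFeasible I = Feasible I × (∀ J → Feasible J → ∣ J ∣ ≤ ∣ I ∣)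

  -- Patience sorting. Piles are lists of indices, top element first;
  -- the list of piles is P_0, P_1, ... (only the nonempty ones, new piles
  -- are opened at the right end, which is the leftmost empty pile).
  insertPile : Fin n → List (List (Fin n)) → List (List (Fin n))
  insertPile i [] = (i ∷ []) ∷ []
  insertPile i ([] ∷ ps) = (i ∷ []) ∷ ps
  insertPile i ((t ∷ p) ∷ ps) =
    if a i <ᵇ a t then (i ∷ t ∷ p) ∷ ps else (t ∷ p) ∷ insertPile i ps

  piles : List (List (Fin n))
  piles = foldl (λ ps i → insertPile i ps) [] (allFin n)

  data Above (v u : Fin n) : List (Fin n) → Set where
    here  : ∀ {xs} → u LM.∈ xs → Above v u (v ∷ xs)
    there : ∀ {x xs} → Above v u xs → Above v u (x ∷ xs)

  PlacedBelow : Fin n → Fin n → Set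
  PlacedBelow u v = Any (Above v u) (drop 1 piles)

  _◁_ : Subset n → Subset n → Set
  I ◁ J = MaxFeasible I × MaxFeasible J ×
    Data.Product.Σ (Fin n) (λ u → Data.Product.Σ (Fin n) (λ v →
      (I ─ J ≡ ⁅ u ⁆) × (J ─ I ≡ ⁅ v ⁆) × PlacedBelow u v))

  data InM (I : Subset n) : Subset n → Set where
    base : InM I I
    step : ∀ {J J'} → InM I J → J' ◁ J → InM I J'

  Minimal : Subset n → Set
  Minimal J = MaxFeasible J × (∀ J' → ¬ (J' ◁ J))

{-# OPTIONS --safe #-}
module Submission where

-- Descending along ◁ is confluent, because ◁ is subcommutative: two
-- sets J₁, J₂ obtained from J by exchanging v₁ for u₁ and v₂ for u₂ (each uᵢ
-- placed below vᵢ) can be brought together in at most one step each.  If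
-- v₁ = v₂, then u₁ and u₂ lie on the pile of v₁, one below the other, so J₁
-- and J₂ are themselves ◁-related.  If v₁ ≠ v₂, performing both exchanges
-- gives a set that is again feasible, since uᵢ sits before vᵢ with a larger
-- value, and of the same size.  A ◁-minimal set is a normal form, and since
-- 𝓜(I) ⊆ 𝓜(J) both minimal sets are the unique normal form below J.

open import Defs
open import Data.Nat using (ℕ; suc; _≤_; _<_; _+_; _<ᵇ_)
import Data.Nat.Properties as ℕ
open import Data.Fin using (Fin; zero) renaming (_<_ to _<ᶠ_)
import Data.Fin.Properties as Fin
open import Data.Fin.Subset using (Subset; _∈_; _∉_; ⁅_⁆; _─_; _-_; _∪_; ∣_∣; _⊆_; inside; outside)
open import Data.Fin.Subset.Properties
  using (_∈?_; x∈⁅x⁆; x∈⁅y⁆⇒x≡y; ∣⁅x⁆∣≡1; x∈p∪q⁺; x∈p∪q⁻; x∈p∧x∉q⇒x∈p─q; p─q⊆p; ⊆-antisym)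
open import Data.Vec using ([]; _∷_)
import Data.Vec as Vec
open import Data.Bool using (true; false; T)
open import Data.Unit using (tt)
open import Data.Empty using (⊥-elim)
open import Data.Product as Product using (_×_; _,_; proj₁; proj₂; ∃; ∃-syntax)
open import Data.Sum as Sum using (_⊎_; inj₁; inj₂; [_,_]′)
open import Data.List using (List; []; _∷_; _++_; concat; foldl; allFin; drop)
open import Data.List.Properties using (++-identityʳ)
open import Data.List.Relation.Unary.All as All using (All; []; _∷_)
import Data.List.Relation.Unary.All.Properties as All
open import Data.List.Relation.Unary.Any as Any using (Any; here; there)
open import Data.List.Relation.Unary.AllPairs using (AllPairs; []; _∷_)
import Data.List.Relation.Unary.AllPairs.Properties as AllPairs
open import Data.List.Relation.Unary.Linked using (Linked; [-]; _∷_)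
open import Data.List.Relation.Unary.Linked.Properties using (Linked⇒All)
open import Data.List.Relation.Unary.Unique.Propositional using (Unique)
open import Data.List.Relation.Unary.Unique.Propositional.Properties using (allFin⁺)
open import Data.List.Relation.Binary.Disjoint.Propositional using (Disjoint)
open import Data.List.Membership.Propositional using () renaming (_∈_ to _∈ₗ_)
open import Data.List.Membership.Propositional.Properties using (∈-concat⁺)
open import Data.List.Relation.Binary.Permutation.Propositional
  using (_↭_; ↭-refl; ↭-sym; ↭⇒↭ₛ; module PermutationReasoning)
open import Data.List.Relation.Binary.Permutation.Propositional.Properties using (++⁺ˡ; shift; All-resp-↭)
import Data.List.Relation.Binary.Permutation.Setoid.Properties as Permutationₛ
open import Function using (_∘_; id)
open import Function.Definitions using (Injective)
open import Relation.Binary using (Rel)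
open import Relation.Binary.PropositionalEquality
  using (_≡_; _≢_; refl; sym; trans; cong; subst; setoid; module ≡-Reasoning)
open import Relation.Binary.Construct.Closure.Reflexive using (ReflClosure; refl; [_]; reflexive)
open import Relation.Binary.Construct.Closure.ReflexiveTransitive using (Star; ε; _◅_; _◅◅_)
open import Relation.Binary.Construct.Closure.Equivalence.Properties using (a—↠b&a—↠c⇒b↔c)
open import Relation.Binary.Rewriting using (Confluent; IsNormalForm; conf⇒unf)
open import Relation.Nullary using (¬_; yes; no)

private
  variable
    m : ℕ
    x u v u₁ u₂ v₁ v₂ : Fin m
    p q I J K J₁ J₂ : Subset m

Unique-resp-↭ : {xs ys : List (Fin m)} → xs ↭ ys → Unique xs → Unique ys
Unique-resp-↭ = Permutationₛ.Unique-resp-↭ (setoid _) ∘ ↭⇒↭ₛ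

Unique-++⁻ : ∀ (xs : List (Fin m)) {ys} → Unique (xs ++ ys) → Unique xs × Unique ys × Disjoint xs ys
Unique-++⁻ [] u = [] , u , λ ()
Unique-++⁻ (x ∷ xs) (x∉ ∷ u) with Unique-++⁻ xs u
... | uxs , uys , disjoint = All.++⁻ˡ xs x∉ ∷ uxs , uys , λ where
  (here refl , x∈ys) → All.lookup (All.++⁻ʳ xs x∉) x∈ys refl
  (there v∈xs , v∈ys) → disjoint (v∈xs , v∈ys)

Unique-concat-drop₁ : ∀ (ps : List (List (Fin m))) → Unique (concat ps) → Unique (concat (drop 1 ps))
Unique-concat-drop₁ [] u = []
Unique-concat-drop₁ (p ∷ ps) u = proj₁ (proj₂ (Unique-++⁻ p u))

x∈p─q⇒x∉q : x ∈ p ─ q → x ∉ q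
x∈p─q⇒x∉q {p = inside ∷ p} {outside ∷ q} Vec.here ()
x∈p─q⇒x∉q {p = _ ∷ p} {_ ∷ q} (Vec.there x∈p─q) (Vec.there x∈q) = x∈p─q⇒x∉q x∈p─q x∈q

∈∉⇒≢ : x ∈ p → u ∉ p → x ≢ u
∈∉⇒≢ x∈p u∉p refl = u∉p x∈p

∣p∣+∣q─p∣≡∣q∣+∣p─q∣ : (p q : Subset m) → ∣ p ∣ + ∣ q ─ p ∣ ≡ ∣ q ∣ + ∣ p ─ q ∣
∣p∣+∣q─p∣≡∣q∣+∣p─q∣ [] [] = refl
∣p∣+∣q─p∣≡∣q∣+∣p─q∣ (inside ∷ p) (inside ∷ q) = cong suc (∣p∣+∣q─p∣≡∣q∣+∣p─q∣ p q)
∣p∣+∣q─p∣≡∣q∣+∣p─q∣ (inside ∷ p) (outside ∷ q) =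
  trans (cong suc (∣p∣+∣q─p∣≡∣q∣+∣p─q∣ p q)) (sym (ℕ.+-suc ∣ q ∣ ∣ p ─ q ∣))
∣p∣+∣q─p∣≡∣q∣+∣p─q∣ (outside ∷ p) (inside ∷ q) =
  trans (ℕ.+-suc ∣ p ∣ ∣ q ─ p ∣) (cong suc (∣p∣+∣q─p∣≡∣q∣+∣p─q∣ p q))
∣p∣+∣q─p∣≡∣q∣+∣p─q∣ (outside ∷ p) (outside ∷ q) = ∣p∣+∣q─p∣≡∣q∣+∣p─q∣ p q

record Exchange (I J : Subset m) (u v : Fin m) : Set where
  field
    u∈I : u ∈ I
    u∉J : u ∉ J
    v∈J : v ∈ J
    v∉I : v ∉ I
    I⊆J+u : x ∈ I → x ∈ J ⊎ x ≡ u
    J-v⊆I : x ∈ J → x ≢ v → x ∈ I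

─≡⁅⁆⇒Exchange : I ─ J ≡ ⁅ u ⁆ → J ─ I ≡ ⁅ v ⁆ → Exchange I J u v
─≡⁅⁆⇒Exchange {I = I} {J} {u} {v} I─J≡u J─I≡v = record
  { u∈I = p─q⊆p I J u∈I─J
  ; u∉J = x∈p─q⇒x∉q u∈I─J
  ; v∈J = p─q⊆p J I v∈J─I
  ; v∉I = x∈p─q⇒x∉q v∈J─I
  ; I⊆J+u = I⊆J+u
  ; J-v⊆I = J-v⊆I
  }
  where
  u∈I─J : u ∈ I ─ J
  u∈I─J = subst (u ∈_) (sym I─J≡u) (x∈⁅x⁆ u)
  v∈J─I : v ∈ J ─ I
  v∈J─I = subst (v ∈_) (sym J─I≡v) (x∈⁅x⁆ v)
  I⊆J+u : x ∈ I → x ∈ J ⊎ x ≡ u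
  I⊆J+u {x = x} x∈I with x ∈? J
  ... | yes x∈J = inj₁ x∈J
  ... | no x∉J = inj₂ (x∈⁅y⁆⇒x≡y u (subst (x ∈_) I─J≡u (x∈p∧x∉q⇒x∈p─q x∈I x∉J)))
  J-v⊆I : x ∈ J → x ≢ v → x ∈ I
  J-v⊆I {x = x} x∈J x≢v with x ∈? I
  ... | yes x∈I = x∈I
  ... | no x∉I = ⊥-elim (x≢v (x∈⁅y⁆⇒x≡y v (subst (x ∈_) J─I≡v (x∈p∧x∉q⇒x∈p─q x∈J x∉I))))

Exchange⇒─≡⁅⁆ : Exchange I J u v → I ─ J ≡ ⁅ u ⁆ × J ─ I ≡ ⁅ v ⁆
Exchange⇒─≡⁅⁆ {I = I} {J} {u} {v} e =
  ⊆-antisym I─J⊆⁅u⁆ (⁅x⁆⊆p─q u∈I u∉J) , ⊆-antisym J─I⊆⁅v⁆ (⁅x⁆⊆p─q v∈J v∉I)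
  where
  open Exchange e
  ⁅x⁆⊆p─q : x ∈ p → x ∉ q → ⁅ x ⁆ ⊆ p ─ q
  ⁅x⁆⊆p─q {x = x} x∈p x∉q y∈⁅x⁆ rewrite x∈⁅y⁆⇒x≡y x y∈⁅x⁆ = x∈p∧x∉q⇒x∈p─q x∈p x∉q
  I─J⊆⁅u⁆ : I ─ J ⊆ ⁅ u ⁆
  I─J⊆⁅u⁆ x∈I─J with I⊆J+u (p─q⊆p I J x∈I─J)
  ... | inj₁ x∈J = ⊥-elim (x∈p─q⇒x∉q x∈I─J x∈J)
  ... | inj₂ refl = x∈⁅x⁆ u
  J─I⊆⁅v⁆ : J ─ I ⊆ ⁅ v ⁆
  J─I⊆⁅v⁆ {x} x∈J─I with x Fin.≟ v
  ... | yes refl = x∈⁅x⁆ v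
  ... | no x≢v = ⊥-elim (x∈p─q⇒x∉q x∈J─I (J-v⊆I (p─q⊆p J I x∈J─I) x≢v))

Exchange⇒∣∣≡ : Exchange I J u v → ∣ I ∣ ≡ ∣ J ∣
Exchange⇒∣∣≡ {I = I} {J} e = ℕ.+-cancelʳ-≡ 1 ∣ I ∣ ∣ J ∣ (begin
  ∣ I ∣ + 1          ≡⟨ cong (∣ I ∣ +_) (sym (∣─∣≡1 J─I≡v)) ⟩
  ∣ I ∣ + ∣ J ─ I ∣  ≡⟨ ∣p∣+∣q─p∣≡∣q∣+∣p─q∣ I J ⟩
  ∣ J ∣ + ∣ I ─ J ∣  ≡⟨ cong (∣ J ∣ +_) (∣─∣≡1 I─J≡u) ⟩
  ∣ J ∣ + 1          ∎)
  where
  open ≡-Reasoning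
  I─J≡u = proj₁ (Exchange⇒─≡⁅⁆ e)
  J─I≡v = proj₂ (Exchange⇒─≡⁅⁆ e)
  ∣─∣≡1 : p ─ q ≡ ⁅ x ⁆ → ∣ p ─ q ∣ ≡ 1
  ∣─∣≡1 {x = x} e = trans (cong ∣_∣ e) (∣⁅x⁆∣≡1 x)

Exchange-unique : Exchange J₁ J u v → Exchange J₂ J u v → J₁ ≡ J₂
Exchange-unique e₁ e₂ = ⊆-antisym (⊆-Exchange e₁ e₂) (⊆-Exchange e₂ e₁)
  where
  ⊆-Exchange : Exchange p J u v → Exchange q J u v → p ⊆ q
  ⊆-Exchange e e′ x∈p with Exchange.I⊆J+u e x∈p
  ... | inj₁ x∈J = Exchange.J-v⊆I e′ x∈J (∈∉⇒≢ x∈p (Exchange.v∉I e))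
  ... | inj₂ refl = Exchange.u∈I e′

Exchange-sameOut : Exchange J₁ J u₁ v → Exchange J₂ J u₂ v → u₁ ≢ u₂ → Exchange J₁ J₂ u₁ u₂
Exchange-sameOut e₁ e₂ u₁≢u₂ = record
  { u∈I = E₁.u∈I
  ; u∉J = [ E₁.u∉J , u₁≢u₂ ]′ ∘ E₂.I⊆J+u
  ; v∈J = E₂.u∈I
  ; v∉I = [ E₂.u∉J , u₁≢u₂ ∘ sym ]′ ∘ E₁.I⊆J+u
  ; I⊆J+u = λ x∈J₁ → Sum.map₁ (λ x∈J → E₂.J-v⊆I x∈J (∈∉⇒≢ x∈J₁ E₁.v∉I)) (E₁.I⊆J+u x∈J₁)
  ; J-v⊆I = λ x∈J₂ x≢u₂ → [ (λ x∈J → E₁.J-v⊆I x∈J (∈∉⇒≢ x∈J₂ E₂.v∉I)) , ⊥-elim ∘ x≢u₂ ]′ (E₂.I⊆J+u x∈J₂)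
  }
  where
  module E₁ = Exchange e₁
  module E₂ = Exchange e₂

Exchange-commute : Exchange J₁ J u₁ v₁ → Exchange J₂ J u₂ v₂ → Exchange K J₁ u₂ v₂ → Exchange K J₂ u₁ v₁
Exchange-commute e₁ e₂ e = record
  { u∈I = E.J-v⊆I E₁.u∈I (∈∉⇒≢ E₂.v∈J E₁.u∉J ∘ sym)
  ; u∉J = λ u₁∈J₂ → [ E₁.u∉J , (λ { refl → E.u∉J E₁.u∈I }) ]′ (E₂.I⊆J+u u₁∈J₂)
  ; v∈J = E₂.J-v⊆I E₁.v∈J (∈∉⇒≢ E.v∈J E₁.v∉I ∘ sym)
  ; v∉I = λ v₁∈K → [ E₁.v∉I , (λ { refl → E₂.u∉J E₁.v∈J }) ]′ (E.I⊆J+u v₁∈K)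
  ; I⊆J+u = λ x∈K → [ (λ x∈J₁ → Sum.map₁ (λ x∈J → E₂.J-v⊆I x∈J (∈∉⇒≢ x∈K E.v∉I)) (E₁.I⊆J+u x∈J₁))
                    , (λ { refl → inj₁ E₂.u∈I }) ]′ (E.I⊆J+u x∈K)
  ; J-v⊆I = λ x∈J₂ x≢v₁ → [ (λ x∈J → E.J-v⊆I (E₁.J-v⊆I x∈J x≢v₁) (∈∉⇒≢ x∈J₂ E₂.v∉I))
                          , (λ { refl → E.u∈I }) ]′ (E₂.I⊆J+u x∈J₂)
  }
  where
  module E = Exchange e
  module E₁ = Exchange e₁
  module E₂ = Exchange e₂

-∪⁅⁆-Exchange : ∀ (J : Subset m) → u ∉ J → v ∈ J → Exchange ((J - v) ∪ ⁅ u ⁆) J u v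
-∪⁅⁆-Exchange {u = u} {v} J u∉J v∈J = record
  { u∈I = x∈p∪q⁺ {p = J - v} (inj₂ (x∈⁅x⁆ u))
  ; u∉J = u∉J
  ; v∈J = v∈J
  ; v∉I = [ (λ v∈J-v → x∈p─q⇒x∉q v∈J-v (x∈⁅x⁆ v)) , (λ v∈⁅u⁆ → ∈∉⇒≢ v∈J u∉J (x∈⁅y⁆⇒x≡y u v∈⁅u⁆)) ]′
          ∘ x∈p∪q⁻ (J - v) ⁅ u ⁆
  ; I⊆J+u = Sum.map (p─q⊆p J ⁅ v ⁆) (x∈⁅y⁆⇒x≡y u) ∘ x∈p∪q⁻ (J - v) ⁅ u ⁆
  ; J-v⊆I = λ x∈J x≢v → x∈p∪q⁺ (inj₁ (x∈p∧x∉q⇒x∈p─q x∈J (x≢v ∘ x∈⁅y⁆⇒x≡y v)))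
  }

module Subcommutation {ℓ₁ ℓ₂} {A : Set ℓ₁} (_⟶_ : Rel A ℓ₂) where

  Subcommutative : Set _
  Subcommutative = ∀ {a b c} → a ⟶ b → a ⟶ c → ∃ λ d → ReflClosure _⟶_ b d × ReflClosure _⟶_ c d

  ⟶⁼⇒⟶* : ∀ {a b} → ReflClosure _⟶_ a b → Star _⟶_ a b
  ⟶⁼⇒⟶* refl = ε
  ⟶⁼⇒⟶* [ a⟶b ] = a⟶b ◅ ε

  module _ (subcomm : Subcommutative) where

    strip : ∀ {a b c} → ReflClosure _⟶_ a b → Star _⟶_ a c → ∃ λ d → Star _⟶_ b d × ReflClosure _⟶_ c d
    strip a⟶⁼b ε = _ , ε , a⟶⁼b
    strip refl a⟶*c = _ , a⟶*c , refl
    strip [ a⟶b ] (a⟶c′ ◅ c′⟶*c) with subcomm a⟶b a⟶c′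
    ... | d′ , b⟶⁼d′ , c′⟶⁼d′ with strip c′⟶⁼d′ c′⟶*c
    ...   | d , d′⟶*d , c⟶⁼d = d , ⟶⁼⇒⟶* b⟶⁼d′ ◅◅ d′⟶*d , c⟶⁼d

    subcomm⇒conf : Confluent _⟶_
    subcomm⇒conf ε a⟶*c = _ , a⟶*c , ε
    subcomm⇒conf (a⟶b′ ◅ b′⟶*b) a⟶*c with strip [ a⟶b′ ] a⟶*c
    ... | d′ , b′⟶*d′ , c⟶⁼d′ with subcomm⇒conf b′⟶*b b′⟶*d′
    ...   | d , b⟶*d , d′⟶*d = d , b⟶*d , ⟶⁼⇒⟶* c⟶⁼d′ ◅◅ d′⟶*d

open Subcommutation using (Subcommutative; subcomm⇒conf)

module _ (a : Fin m → ℕ) where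

  LaterAndSmaller : Fin m → Fin m → Set
  LaterAndSmaller x y = y <ᶠ x × a x < a y

  LaterAndSmaller-trans : ∀ {x y z} → LaterAndSmaller x y → LaterAndSmaller y z → LaterAndSmaller x z
  LaterAndSmaller-trans (y<x , ax<ay) (z<y , ay<az) = Fin.<-trans z<y y<x , ℕ.<-trans ax<ay ay<az

  Linked-Above : ∀ {xs} → Linked LaterAndSmaller xs → Above a v u xs → LaterAndSmaller v u
  Linked-Above (v≻x ∷ l) (Above.here u∈xs) = All.lookup (Linked⇒All LaterAndSmaller-trans v≻x l) u∈xs
  Linked-Above (_ ∷ l) (Above.there ab) = Linked-Above l ab

  Above⇒∈ : ∀ {xs} → Above a v u xs → v ∈ₗ xs
  Above⇒∈ (Above.here _) = here refl
  Above⇒∈ (Above.there ab) = there (Above⇒∈ ab)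

  Above-total : ∀ {xs} → u₁ ∈ₗ xs → u₂ ∈ₗ xs → u₁ ≢ u₂ → Above a u₂ u₁ xs ⊎ Above a u₁ u₂ xs
  Above-total (here refl) (here refl) u₁≢u₂ = ⊥-elim (u₁≢u₂ refl)
  Above-total (here refl) (there u₂∈xs) _ = inj₂ (Above.here u₂∈xs)
  Above-total (there u₁∈xs) (here refl) _ = inj₁ (Above.here u₁∈xs)
  Above-total (there u₁∈xs) (there u₂∈xs) u₁≢u₂ = Sum.map Above.there Above.there (Above-total u₁∈xs u₂∈xs u₁≢u₂)

  Above-sameTop : ∀ {xs} → Unique xs → Above a v u₁ xs → Above a v u₂ xs → u₁ ≢ u₂ →
                  Above a u₂ u₁ xs ⊎ Above a u₁ u₂ xs
  Above-sameTop _ (Above.here u₁∈xs) (Above.here u₂∈xs) u₁≢u₂ =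
    Sum.map Above.there Above.there (Above-total u₁∈xs u₂∈xs u₁≢u₂)
  Above-sameTop (v∉xs ∷ _) (Above.here _) (Above.there ab₂) _ = ⊥-elim (All.lookup v∉xs (Above⇒∈ ab₂) refl)
  Above-sameTop (v∉xs ∷ _) (Above.there ab₁) (Above.here _) _ = ⊥-elim (All.lookup v∉xs (Above⇒∈ ab₁) refl)
  Above-sameTop (_ ∷ u) (Above.there ab₁) (Above.there ab₂) u₁≢u₂ =
    Sum.map Above.there Above.there (Above-sameTop u ab₁ ab₂ u₁≢u₂)

  Any-Above⇒∈ : ∀ {ps} → Any (Above a v u) ps → v ∈ₗ concat ps
  Any-Above⇒∈ = ∈-concat⁺ ∘ Any.map Above⇒∈

  Any-Above-sameTop : ∀ ps → Unique (concat ps) → Any (Above a v u₁) ps → Any (Above a v u₂) ps → u₁ ≢ u₂ →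
                      Any (Above a u₂ u₁) ps ⊎ Any (Above a u₁ u₂) ps
  Any-Above-sameTop (p ∷ ps) u ab₁ ab₂ u₁≢u₂ with Unique-++⁻ p u | ab₁ | ab₂
  ... | up , _ , _ | here ab₁ | here ab₂ = Sum.map here here (Above-sameTop up ab₁ ab₂ u₁≢u₂)
  ... | _ , _ , disjoint | here ab₁ | there ab₂ = ⊥-elim (disjoint (Above⇒∈ ab₁ , Any-Above⇒∈ ab₂))
  ... | _ , _ , disjoint | there ab₁ | here ab₂ = ⊥-elim (disjoint (Above⇒∈ ab₂ , Any-Above⇒∈ ab₁))
  ... | _ , ups , _ | there ab₁ | there ab₂ = Sum.map there there (Any-Above-sameTop ps ups ab₁ ab₂ u₁≢u₂)

  placeAll : List (List (Fin m)) → List (Fin m) → List (List (Fin m))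
  placeAll = foldl (λ ps i → insertPile a i ps)

  insertPile-↭ : ∀ i ps → concat (insertPile a i ps) ↭ i ∷ concat ps
  insertPile-↭ i [] = ↭-refl
  insertPile-↭ i ([] ∷ ps) = ↭-refl
  insertPile-↭ i ((t ∷ p) ∷ ps) with a i <ᵇ a t
  ... | true = ↭-refl
  ... | false = begin
    t ∷ p ++ concat (insertPile a i ps)  ↭⟨ ++⁺ˡ (t ∷ p) (insertPile-↭ i ps) ⟩
    t ∷ p ++ i ∷ concat ps               ↭⟨ shift i (t ∷ p) (concat ps) ⟩
    i ∷ t ∷ p ++ concat ps               ∎
    where open PermutationReasoning

  placeAll-↭ : ∀ ps xs → concat (placeAll ps xs) ↭ xs ++ concat ps
  placeAll-↭ ps [] = ↭-refl
  placeAll-↭ ps (x ∷ xs) = begin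
    concat (placeAll (insertPile a x ps) xs)  ↭⟨ placeAll-↭ (insertPile a x ps) xs ⟩
    xs ++ concat (insertPile a x ps)          ↭⟨ ++⁺ˡ xs (insertPile-↭ x ps) ⟩
    xs ++ x ∷ concat ps                       ↭⟨ shift x xs (concat ps) ⟩
    x ∷ xs ++ concat ps                       ∎
    where open PermutationReasoning

  piles-unique : Unique (concat (piles a))
  piles-unique = Unique-resp-↭ (↭-sym (placeAll-↭ [] (allFin m)))
    (subst Unique (sym (++-identityʳ (allFin m))) (allFin⁺ m))

  insertPile-sorted : ∀ {i} ps → All (Linked LaterAndSmaller) ps → All (_<ᶠ i) (concat ps) →
                      All (Linked LaterAndSmaller) (insertPile a i ps)
  insertPile-sorted [] _ _ = [-] ∷ []
  insertPile-sorted ([] ∷ ps) (_ ∷ sorted) _ = [-] ∷ sorted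
  insertPile-sorted {i} ((t ∷ p) ∷ ps) (l ∷ sorted) (t<i ∷ earlier) with a i <ᵇ a t in eq
  ... | true = ((t<i , ℕ.<ᵇ⇒< (a i) (a t) (subst T (sym eq) tt)) ∷ l) ∷ sorted
  ... | false = l ∷ insertPile-sorted ps sorted (All.++⁻ʳ p earlier)

  placeAll-sorted : ∀ ps {xs} → AllPairs _<ᶠ_ xs → All (λ y → All (y <ᶠ_) xs) (concat ps) →
                    All (Linked LaterAndSmaller) ps → All (Linked LaterAndSmaller) (placeAll ps xs)
  placeAll-sorted ps [] _ sorted = sorted
  placeAll-sorted ps {x ∷ _} (x<xs ∷ increasing) earlier sorted =
    placeAll-sorted (insertPile a x ps) increasing
      (All-resp-↭ (↭-sym (insertPile-↭ x ps)) (x<xs ∷ All.map All.tail earlier))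
      (insertPile-sorted ps sorted (All.map All.head earlier))

  piles-sorted : All (Linked LaterAndSmaller) (piles a)
  piles-sorted = placeAll-sorted [] (AllPairs.tabulate⁺-< id) [] []

  PlacedBelow⇒LaterAndSmaller : PlacedBelow a u v → LaterAndSmaller v u
  PlacedBelow⇒LaterAndSmaller = go (All.drop⁺ 1 piles-sorted)
    where
    go : ∀ {ps} → All (Linked LaterAndSmaller) ps → Any (Above a v u) ps → LaterAndSmaller v u
    go (l ∷ _) (here ab) = Linked-Above l ab
    go (_ ∷ sorted) (there ab) = go sorted ab

  PlacedBelow-sameTop : PlacedBelow a u₁ v → PlacedBelow a u₂ v → u₁ ≢ u₂ →
                        PlacedBelow a u₁ u₂ ⊎ PlacedBelow a u₂ u₁
  PlacedBelow-sameTop = Any-Above-sameTop _ (Unique-concat-drop₁ (piles a) piles-unique)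

  Feasible⇒¬PlacedBelow : Feasible a J → u ∈ J → v ∈ J → ¬ PlacedBelow a u v
  Feasible⇒¬PlacedBelow {u = u} {v} feasible u∈J v∈J pb =
    ℕ.<-asym (feasible u v u∈J v∈J u<v) av<au
    where
    u<v = proj₁ (PlacedBelow⇒LaterAndSmaller pb)
    av<au = proj₂ (PlacedBelow⇒LaterAndSmaller pb)

  Feasible⇒<-PlacedBelow : Feasible a J → x ∈ J → v ∈ J → PlacedBelow a u v → x <ᶠ u → a x < a u
  Feasible⇒<-PlacedBelow {x = x} {v} feasible x∈J v∈J pb x<u =
    ℕ.<-trans (feasible x v x∈J v∈J (Fin.<-trans x<u u<v)) av<au
    where
    u<v = proj₁ (PlacedBelow⇒LaterAndSmaller pb)
    av<au = proj₂ (PlacedBelow⇒LaterAndSmaller pb)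

  -- Any two elements of K, unless they are u₁ and u₂, lie together in J₁ or in J₂.
  Exchange-Feasible : Feasible a J₁ → Feasible a J₂ → Exchange K J₁ u₂ v₂ → Exchange K J₂ u₁ v₁ → u₂ ∈ J₂ →
                      (u₁ <ᶠ u₂ → a u₁ < a u₂) → (u₂ <ᶠ u₁ → a u₂ < a u₁) → Feasible a K
  Exchange-Feasible f₁ f₂ e₁ e₂ u₂∈J₂ u₁↗u₂ u₂↗u₁ i j i∈K j∈K i<j
    with Exchange.I⊆J+u e₁ i∈K | Exchange.I⊆J+u e₁ j∈K
  ... | inj₁ i∈J₁ | inj₁ j∈J₁ = f₁ i j i∈J₁ j∈J₁ i<j
  ... | inj₂ refl | inj₂ refl = ⊥-elim (Fin.<-irrefl refl i<j)
  ... | inj₁ _ | inj₂ refl = [ (λ i∈J₂ → f₂ i j i∈J₂ u₂∈J₂ i<j) , (λ { refl → u₁↗u₂ i<j }) ]′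
                               (Exchange.I⊆J+u e₂ i∈K)
  ... | inj₂ refl | inj₁ _ = [ (λ j∈J₂ → f₂ i j u₂∈J₂ j∈J₂ i<j) , (λ { refl → u₂↗u₁ i<j }) ]′
                               (Exchange.I⊆J+u e₂ j∈K)

  MaxFeasible-Exchange : MaxFeasible a J → Exchange K J u v → Feasible a K → MaxFeasible a K
  MaxFeasible-Exchange (_ , maximal) e feasible =
    feasible , λ L fL → subst (∣ L ∣ ≤_) (sym (Exchange⇒∣∣≡ e)) (maximal L fL)

  Exchange⇒◁ : MaxFeasible a I → MaxFeasible a J → Exchange I J u v → PlacedBelow a u v → _◁_ a I J
  Exchange⇒◁ mI mJ e pb = mI , mJ , _ , _ , proj₁ (Exchange⇒─≡⁅⁆ e) , proj₂ (Exchange⇒─≡⁅⁆ e) , pb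

  _▷_ : Subset m → Subset m → Set
  J ▷ K = _◁_ a K J

  ◁-sameTop : MaxFeasible a J₁ → MaxFeasible a J₂ → Exchange J₁ J u₁ v → Exchange J₂ J u₂ v →
              PlacedBelow a u₁ v → PlacedBelow a u₂ v → ∃[ K ] (ReflClosure _▷_ J₁ K × ReflClosure _▷_ J₂ K)
  ◁-sameTop {u₁ = u₁} {u₂ = u₂} m₁ m₂ e₁ e₂ pb₁ pb₂ with u₁ Fin.≟ u₂
  ... | yes refl = _ , refl , reflexive (sym (Exchange-unique e₁ e₂))
  ... | no u₁≢u₂ with PlacedBelow-sameTop pb₁ pb₂ u₁≢u₂
  ...   | inj₁ pb = _ , refl , [ Exchange⇒◁ m₁ m₂ (Exchange-sameOut e₁ e₂ u₁≢u₂) pb ]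
  ...   | inj₂ pb = _ , [ Exchange⇒◁ m₂ m₁ (Exchange-sameOut e₂ e₁ (u₁≢u₂ ∘ sym)) pb ] , refl

  ◁-distinctTops : MaxFeasible a J₁ → MaxFeasible a J₂ → Exchange J₁ J u₁ v₁ → Exchange J₂ J u₂ v₂ →
                   PlacedBelow a u₁ v₁ → PlacedBelow a u₂ v₂ → v₁ ≢ v₂ → ∃[ K ] (J₁ ▷ K × J₂ ▷ K)
  ◁-distinctTops {J₁ = J₁} {J₂} {u₁ = u₁} {v₁} {u₂} {v₂} m₁ m₂ e₁ e₂ pb₁ pb₂ v₁≢v₂ =
    J₁₂ , Exchange⇒◁ mJ₁₂ m₁ e₁′ pb₂ , Exchange⇒◁ mJ₁₂ m₂ e₂′ pb₁
    where
    module E₁ = Exchange e₁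
    module E₂ = Exchange e₂
    v₁∈J₂ : v₁ ∈ J₂
    v₁∈J₂ = E₂.J-v⊆I E₁.v∈J v₁≢v₂
    v₂∈J₁ : v₂ ∈ J₁
    v₂∈J₁ = E₁.J-v⊆I E₂.v∈J (v₁≢v₂ ∘ sym)
    u₁≢u₂ : u₁ ≢ u₂
    u₁≢u₂ refl = Feasible⇒¬PlacedBelow (proj₁ m₂) E₂.u∈I v₁∈J₂ pb₁
    J₁₂ : Subset _
    J₁₂ = (J₁ - v₂) ∪ ⁅ u₂ ⁆
    e₁′ : Exchange J₁₂ J₁ u₂ v₂
    e₁′ = -∪⁅⁆-Exchange J₁ ([ E₂.u∉J , u₁≢u₂ ∘ sym ]′ ∘ E₁.I⊆J+u) v₂∈J₁
    e₂′ : Exchange J₁₂ J₂ u₁ v₁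
    e₂′ = Exchange-commute e₁ e₂ e₁′
    mJ₁₂ : MaxFeasible a J₁₂
    mJ₁₂ = MaxFeasible-Exchange m₁ e₁′ (Exchange-Feasible (proj₁ m₁) (proj₁ m₂) e₁′ e₂′ E₂.u∈I
           (Feasible⇒<-PlacedBelow (proj₁ m₁) E₁.u∈I v₂∈J₁ pb₂)
           (Feasible⇒<-PlacedBelow (proj₁ m₂) E₂.u∈I v₁∈J₂ pb₁))

  ▷-subcommutative : Subcommutative _▷_
  ▷-subcommutative (m₁ , _ , u₁ , v₁ , J₁─J≡⁅u₁⁆ , J─J₁≡⁅v₁⁆ , pb₁)
                   (m₂ , _ , u₂ , v₂ , J₂─J≡⁅u₂⁆ , J─J₂≡⁅v₂⁆ , pb₂)
    with ─≡⁅⁆⇒Exchange J₁─J≡⁅u₁⁆ J─J₁≡⁅v₁⁆ | ─≡⁅⁆⇒Exchange J₂─J≡⁅u₂⁆ J─J₂≡⁅v₂⁆ | v₁ Fin.≟ v₂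
  ... | e₁ | e₂ | yes refl = ◁-sameTop m₁ m₂ e₁ e₂ pb₁ pb₂
  ... | e₁ | e₂ | no v₁≢v₂ = Product.map₂ (Product.map [_] [_]) (◁-distinctTops m₁ m₂ e₁ e₂ pb₁ pb₂ v₁≢v₂)

  InM⇒Star : InM a I K → Star _▷_ I K
  InM⇒Star InM.base = ε
  InM⇒Star (InM.step I⟶*J K◁J) = InM⇒Star I⟶*J ◅◅ (K◁J ◅ ε)

  Minimal⇒IsNormalForm : Minimal a K → IsNormalForm _▷_ K
  Minimal⇒IsNormalForm (_ , minimal) (L , L◁K) = minimal L L◁K

-- Neither that a is a permutation of 1..n nor that a₀ = 0 is needed.
corollary2 : (n : ℕ) (a : Fin (suc n) → ℕ) →
    a zero ≡ 0 →
    (∀ i → 1 ≤ a (Data.Fin.suc i) × a (Data.Fin.suc i) ≤ n) →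
    Injective _≡_ _≡_ a →
    (I J : Subset (suc n)) → MaxFeasible a I → MaxFeasible a J → _◁_ a I J →
    (K L : Subset (suc n)) →
    InM a I K → Minimal a K → InM a J L → Minimal a L →
    K ≡ L
corollary2 n a _ _ _ I J _ _ I◁J K L I⟶*K K-minimal J⟶*L L-minimal =
  conf⇒unf (subcomm⇒conf (_▷_ a) (▷-subcommutative a))
    (Minimal⇒IsNormalForm a K-minimal) (Minimal⇒IsNormalForm a L-minimal)
    (a—↠b&a—↠c⇒b↔c (I◁J ◅ InM⇒Star a I⟶*K) (InM⇒Star a J⟶*L))
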